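{- Let $\mathcal{U}=\{U_k\}_{k\in\mathbb{N}}$ and $\mathcal{V}=\{V_l\}_{l\in\mathbb{N}}$ be sequences of sets and let $\mathbf{C}$ be the class of all $(\mathcal{U},\mathcal{V})$-computable partial functions from $\bigcup_{k=0}^\infty U_k$ to $\bigcup_{l=0}^\infty V_l$. Then every finite collection of effective $\hat{\mathcal{U}}$-unions is strongly join permitting for $\mathbf{C}$.
   Context: For $x\in\bigcup_k U_k$, $\mathcal{U}^{ -1}(x)=\{k\in\mathbb{N}\mid x\in U_k\}$; its total enumerations (total functions $\mathbb{N}\to\mathbb{N}$ with range $\mathcal{U}^{ -1}(x)$) are the $\mathcal{U}$-names of $x$; similarly for $\mathcal{V}$. Let $D_0,D_1,\dots$ be the canonical enumeration of all finite subsets of $\mathbb{N}$, and $\hat U_m=\bigcap_{k\in D_m}U_k$, with the empty intersection taken to be $\bigcup_k U_k$. An effective $\hat{\mathcal{U}}$-union is a set $\bigcup_{m\in S}\hat U_m$ with $S\subseteq\mathbb{N}$ recursively enumerable. A partial function $f$ from $\bigcup_k U_k$ to $\bigcup_l V_l$ is $(\mathcal{U},\mathcal{V})$-computable if there is a recursive operator $\Gamma$ (on total functions $\mathbb{N}\to\mathbb{N}$) such that for every $x\in\mathrm{dom}(f)$, $\Gamma$ transforms every $\mathcal{U}$-name of $x$ into a $\mathcal{V}$-name of $f(x)$. Functions are sets of ordered pairs; $f\!\upharpoonright_A$ is the restriction of $f$ to $A\cap\mathrm{dom}(f)$. A collection $\mathcal{A}$ of sets is strongly join permitting for $\mathbf{C}$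 if for every function $f$ with $\mathrm{dom}(f)\subseteq\bigcup\mathcal{A}$: if $f\!\upharpoonright_A\in\mathbf{C}$ for all $A\in\mathcal{A}$, then $f\in\mathbf{C}$. -}

module Defs where

open import Data.Nat using (ℕ; zero; suc; _<_; _/_; _%_)
open import Data.Fin using (Fin)
open import Data.Vec using (Vec; []; _∷_; lookup)
open import Data.Product using (Σ; ∃; _×_; _,_)
open import Relation.Binary.PropositionalEquality using (_≡_)
open import Function.Bundles using (_⇔_)

data Term : ℕ → Set where
  zer    : ∀ {n} → Term n
  succ   : Term 1
  proj   : ∀ {n} → Fin n → Term n
  oracle : Term 1
  comp   : ∀ {m n} → Term m → Vec (Term n) m → Term n
  prec   : ∀ {n} → Term n → Term (suc (suc n)) → Term (suc n)
  mu     : ∀ {n} → Term (suc n) → Term n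

mutual
  data _⊢_[_]⇓_ (g : ℕ → ℕ) : ∀ {n} → Term n → Vec ℕ n → ℕ → Set where
    ev-zer  : ∀ {n} {xs : Vec ℕ n} → g ⊢ zer [ xs ]⇓ 0
    ev-succ : ∀ {x} → g ⊢ succ [ x ∷ [] ]⇓ suc x
    ev-proj : ∀ {n} {i : Fin n} {xs} → g ⊢ proj i [ xs ]⇓ lookup xs i
    ev-orac : ∀ {x} → g ⊢ oracle [ x ∷ [] ]⇓ g x
    ev-comp : ∀ {m n} {h : Term m} {fs : Vec (Term n) m} {xs ys v} →
              g ⊢ fs [ xs ]⇓* ys → g ⊢ h [ ys ]⇓ v → g ⊢ comp h fs [ xs ]⇓ v
    ev-prec0 : ∀ {n} {f : Term n} {h : Term (suc (suc n))} {xs v} →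
               g ⊢ f [ xs ]⇓ v → g ⊢ prec f h [ 0 ∷ xs ]⇓ v
    ev-precS : ∀ {n} {f : Term n} {h : Term (suc (suc n))} {k xs r v} →
               g ⊢ prec f h [ k ∷ xs ]⇓ r → g ⊢ h [ k ∷ r ∷ xs ]⇓ v →
               g ⊢ prec f h [ suc k ∷ xs ]⇓ v
    ev-mu   : ∀ {n} {f : Term (suc n)} {xs y} →
              g ⊢ f [ y ∷ xs ]⇓ 0 →
              (∀ i → i < y → Σ ℕ λ w → g ⊢ f [ i ∷ xs ]⇓ suc w) →
              g ⊢ mu f [ xs ]⇓ y

  data _⊢_[_]⇓*_ (g : ℕ → ℕ) {n} : ∀ {m} → Vec (Term n) m → Vec ℕ n → Vec ℕ m → Set where
    ev-[] : ∀ {xs} → g ⊢ [] [ xs ]⇓* []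
    ev-∷  : ∀ {m} {f : Term n} {fs : Vec (Term n) m} {xs v vs} →
            g ⊢ f [ xs ]⇓ v → g ⊢ fs [ xs ]⇓* vs → g ⊢ (f ∷ fs) [ xs ]⇓* (v ∷ vs)

Operator : Set
Operator = Term 1

_transforms_into_ : Operator → (ℕ → ℕ) → (ℕ → ℕ) → Set
e transforms p into q = ∀ n → p ⊢ e [ n ∷ [] ]⇓ q n

-- Recursively enumerable sets of naturals: domains of partial recursive
-- functions (the oracle is the constant-zero function, i.e. no oracle).
_∈RE_ : ℕ → Term 1 → Set
m ∈RE e = Σ ℕ λ v → (λ _ → 0) ⊢ e [ m ∷ [] ]⇓ v

IsRE : (ℕ → Set) → Set
IsRE S = Σ (Term 1) λ e → ∀ m → S m ⇔ (m ∈RE e)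

-- Canonical enumeration of finite sets: k ∈ D_m iff bit k of m is 1.

bit : ℕ → ℕ → ℕ
bit m zero    = m % 2
bit m (suc k) = bit (m / 2) k

_∈D_ : ℕ → ℕ → Set
k ∈D m = bit m k ≡ 1

Family : Set → Set₁
Family X = ℕ → X → Set

⋃ : ∀ {X} → Family X → X → Set
⋃ U x = ∃ λ k → U k x

IsName : ∀ {X} → Family X → X → (ℕ → ℕ) → Set
IsName U x p = (∀ n → U (p n) x) × (∀ k → U k x → ∃ λ n → p n ≡ k)

-- Û_m = ⋂_{k ∈ D_m} U_k, the empty intersection being ⋃_k U_k
Û : ∀ {X} → Family X → Family X
Û U m x = (∀ k → k ∈D m → U k x) × ⋃ U x

IsEffUnion : ∀ {X} → Family X → (X → Set) → Set₁
IsEffUnion U A = ∃ λ (S : ℕ → Set) → IsRE S × (∀ x → A x ⇔ (∃ λ m → S m × Û U m x))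

IsFunction : ∀ {X Y : Set} → (X → Y → Set) → Set
IsFunction F = ∀ {x y y'} → F x y → F x y' → y ≡ y'

dom : ∀ {X Y : Set} → (X → Y → Set) → X → Set
dom F x = ∃ λ y → F x y

restrict : ∀ {X Y : Set} → (X → Y → Set) → (X → Set) → X → Y → Set
restrict F A x y = A x × F x y

InC : ∀ {X Y : Set} → Family X → Family Y → (X → Y → Set) → Set
InC U V F =
  IsFunction F × (∀ {x y} → F x y → ⋃ U x × ⋃ V y) ×
  (∃ λ (Γ : Operator) → ∀ {x y} → F x y → ∀ p → IsName U x p →
     ∃ λ q → (Γ transforms p into q) × IsName V y q)

StronglyJoinPermitting : ∀ {X Y : Set} → Family X → Family Y →
                         ∀ {I : Set} → (I → X → Set) → Set₁
StronglyJoinPermitting {X} {Y} U V {I} 𝒜 =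
  (F : X → Y → Set) → IsFunction F →
  (∀ {x} → dom F x → ∃ λ i → 𝒜 i x) →
  (∀ i → InC U V (restrict F (𝒜 i))) →
  InC U V F

module Submission where

-- Let eᵢ enumerate Sᵢ, where 𝒜ᵢ = ⋃_{m ∈ Sᵢ} Ûₘ, and let γᵢ compute f on 𝒜ᵢ. For a U-name p of x,
-- x ∈ Ûₘ iff every k ∈ Dₘ occurs among the values of p, so x ∈ 𝒜ᵢ is semi-decidable from p,
-- uniformly in i. The join operator searches for the first stage s at which, for some i, some
-- m < s has been enumerated by eᵢ within s steps and Dₘ ⊆ {p 0, …, p (s − 1)}, and then runs γᵢ
-- for the first such i. That search succeeds because x lies in some 𝒜ᵢ, and whichever i it finds
-- has x ∈ 𝒜ᵢ, so γᵢ turns p into a V-name of f x. To run eᵢ and γᵢ under a clock inside a single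
-- term, the proof uses a step-bounded interpreter for terms, itself written as a μ-free term.

open import Defs
open import Data.Nat using (ℕ; zero; suc; _<_; _≤_; _∸_; _+_; pred; z≤n; s≤s; _⊔_; _/_; _%_; _≟_)
open import Data.Nat.Properties
open import Data.Nat.DivMod using (m/n≡1+[m∸n]/n; [m+n]%n≡m%n; m/n<m)
open import Data.Fin using (Fin; zero; suc; _↑ʳ_)
open import Data.Vec using (Vec; []; _∷_; _++_; head; tail; lookup; tabulate; map)
open import Data.Vec.Properties using (tabulate∘lookup; tabulate-cong; lookup-++ʳ)
open import Data.Product using (∃; _×_; _,_; proj₁; proj₂)
open import Data.Sum using (_⊎_; inj₁; inj₂)
open import Data.Empty using (⊥-elim)
open import Function using (_∘_)
open import Function.Bundles using (_⇔_; mk⇔; Equivalence)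
open import Relation.Binary.PropositionalEquality
open import Relation.Nullary using (yes; no)

-- μ-free terms with a total meaning

record Total (n : ℕ) : Set where
  constructor total
  field
    term      : Term n
    ⟦_⟧       : (ℕ → ℕ) → Vec ℕ n → ℕ
    evaluates : ∀ g xs → g ⊢ term [ xs ]⇓ ⟦_⟧ g xs
open Total public

withDenotation : ∀ {n} (t : Total n) (f : (ℕ → ℕ) → Vec ℕ n → ℕ) →
                 (∀ g xs → ⟦ t ⟧ g xs ≡ f g xs) → Total n
withDenotation t f eq =
  total (term t) f (λ g xs → subst (g ⊢ term t [ xs ]⇓_) (eq g xs) (evaluates t g xs))

zeroₜ : ∀ {n} → Total n
zeroₜ = total zer (λ _ _ → 0) (λ _ _ → ev-zer)

sucₜ : Total 1
sucₜ = total succ (λ _ xs → suc (head xs)) (λ { _ (_ ∷ []) → ev-succ })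

oracleₜ : Total 1
oracleₜ = total oracle (λ g xs → g (head xs)) (λ { _ (_ ∷ []) → ev-orac })

π : ∀ {n} → Fin n → Total n
π i = total (proj i) (λ _ xs → lookup xs i) (λ _ _ → ev-proj)

terms : ∀ {m n} → Vec (Total n) m → Vec (Term n) m
terms []       = []
terms (t ∷ ts) = term t ∷ terms ts

⟦_⟧* : ∀ {m n} → Vec (Total n) m → (ℕ → ℕ) → Vec ℕ n → Vec ℕ m
⟦ [] ⟧*     g xs = []
⟦ t ∷ ts ⟧* g xs = ⟦ t ⟧ g xs ∷ ⟦ ts ⟧* g xs

evaluates* : ∀ {m n} (ts : Vec (Total n) m) g xs → g ⊢ terms ts [ xs ]⇓* ⟦ ts ⟧* g xs
evaluates* []       g xs = ev-[]
evaluates* (t ∷ ts) g xs = ev-∷ (evaluates t g xs) (evaluates* ts g xs)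

infixr 9 _∘ₜ_
_∘ₜ_ : ∀ {m n} → Total m → Vec (Total n) m → Total n
h ∘ₜ ts = total (comp (term h) (terms ts)) (λ g xs → ⟦ h ⟧ g (⟦ ts ⟧* g xs))
                (λ g xs → ev-comp (evaluates* ts g xs) (evaluates h g _))

natRec : ∀ {A : Set} → A → (ℕ → A → A) → ℕ → A
natRec b s zero    = b
natRec b s (suc k) = s k (natRec b s k)

natRec-cong : ∀ {A : Set} {b b′ : A} (s s′ : ℕ → A → A) → b ≡ b′ → (∀ k r → s k r ≡ s′ k r) →
              ∀ k → natRec b s k ≡ natRec b′ s′ k
natRec-cong s s′ eqᵇ eqˢ zero    = eqᵇ
natRec-cong s s′ eqᵇ eqˢ (suc k) = trans (cong (s k) (natRec-cong s s′ eqᵇ eqˢ k)) (eqˢ k _)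

recₜ : ∀ {n} → Total n → Total (suc (suc n)) → Total (suc n)
recₜ {n} f h = total (prec (term f) (term h)) denote (λ g xs → go g xs)
  where
  denote : (ℕ → ℕ) → Vec ℕ (suc n) → ℕ
  denote g (k ∷ xs) = natRec (⟦ f ⟧ g xs) (λ i r → ⟦ h ⟧ g (i ∷ r ∷ xs)) k
  go : ∀ g xs → g ⊢ prec (term f) (term h) [ xs ]⇓ denote g xs
  go g (zero  ∷ xs) = ev-prec0 (evaluates f g xs)
  go g (suc k ∷ xs) = ev-precS (go g (k ∷ xs)) (evaluates h g _)

⟦π∘⟧* : ∀ {m k} (f : Fin m → Fin k) g zs →
        ⟦ tabulate (π ∘ f) ⟧* g zs ≡ tabulate (lookup zs ∘ f)
⟦π∘⟧* {zero}  f g zs = refl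
⟦π∘⟧* {suc m} f g zs = cong (lookup zs (f zero) ∷_) (⟦π∘⟧* (f ∘ suc) g zs)

rest : ∀ k {n} → Vec (Total (k + n)) n
rest k = tabulate (π ∘ (k ↑ʳ_))

⟦rest⟧* : ∀ {k n} g (zs : Vec ℕ k) (ys : Vec ℕ n) → ⟦ rest k ⟧* g (zs ++ ys) ≡ ys
⟦rest⟧* {k} g zs ys = begin
  ⟦ rest k ⟧* g (zs ++ ys)                 ≡⟨ ⟦π∘⟧* (k ↑ʳ_) g (zs ++ ys) ⟩
  tabulate (lookup (zs ++ ys) ∘ (k ↑ʳ_))   ≡⟨ tabulate-cong (lookup-++ʳ zs ys) ⟩
  tabulate (lookup ys)                     ≡⟨ tabulate∘lookup ys ⟩
  ys                                       ∎
  where open ≡-Reasoning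

-- Truth values are coded as naturals, 0 meaning false.
if0 : ℕ → ℕ → ℕ → ℕ
if0 zero    a b = a
if0 (suc _) a b = b

isZero : ℕ → ℕ
isZero a = if0 a 1 0

guard : ℕ → ℕ → ℕ
guard a b = if0 a 0 b

_orElse_ : ℕ → ℕ → ℕ
a orElse b = if0 a b a

equal : ℕ → ℕ → ℕ
equal a b = guard (isZero (a ∸ b)) (isZero (b ∸ a))

anyBelow : (ℕ → ℕ) → ℕ → ℕ
anyBelow h s = natRec 0 (λ i r → r orElse h i) s

if0ₜ : ∀ {n} → Total n → Total n → Total n → Total n
if0ₜ c a b = if0Base ∘ₜ (c ∷ a ∷ b ∷ [])
  where
  if0Base : Total 3
  if0Base = withDenotation (recₜ (π zero) (π (suc (suc (suc zero)))))
              (λ _ xs → if0 (head xs) (lookup xs (suc zero)) (lookup xs (suc (suc zero))))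
              (λ { _ (zero ∷ _) → refl ; _ (suc _ ∷ _) → refl })

predₜ : ∀ {n} → Total n → Total n
predₜ x = predBase ∘ₜ (x ∷ [])
  where
  predBase : Total 1
  predBase = withDenotation (recₜ zeroₜ (π zero)) (λ _ xs → pred (head xs))
               (λ { _ (zero ∷ []) → refl ; _ (suc _ ∷ []) → refl })

oneₜ : ∀ {n} → Total n
oneₜ = sucₜ ∘ₜ (zeroₜ ∷ [])

isZeroₜ : ∀ {n} → Total n → Total n
isZeroₜ x = if0ₜ x oneₜ zeroₜ

guardₜ : ∀ {n} → Total n → Total n → Total n
guardₜ x y = if0ₜ x zeroₜ y

orElseₜ : ∀ {n} → Total n → Total n → Total n
orElseₜ x y = if0ₜ x y x

_∸ₜ_ : ∀ {n} → Total n → Total n → Total n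
a ∸ₜ b = monusBase ∘ₜ (a ∷ b ∷ [])
  where
  natRec-pred : ∀ a b → natRec a (λ _ → pred) b ≡ a ∸ b
  natRec-pred a zero    = refl
  natRec-pred a (suc b) = trans (cong pred (natRec-pred a b)) (pred[m∸n]≡m∸[1+n] a b)
  monusBase : Total 2
  monusBase = withDenotation (recₜ (π zero) (predₜ (π (suc zero))) ∘ₜ (π (suc zero) ∷ π zero ∷ []))
                (λ _ xs → head xs ∸ head (tail xs)) (λ { _ (a ∷ b ∷ []) → natRec-pred a b })

equalₜ : ∀ {n} → Total n → Total n → Total n
equalₜ a b = guardₜ (isZeroₜ (a ∸ₜ b)) (isZeroₜ (b ∸ₜ a))

anyBelowₜ : ∀ {n} → Total (suc n) → Total (suc n)
anyBelowₜ {n} f = withDenotation (recₜ zeroₜ (orElseₜ (π (suc zero)) (f ∘ₜ (π zero ∷ rest 2))))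
                    (λ g xs → anyBelow (λ i → ⟦ f ⟧ g (i ∷ tail xs)) (head xs))
                    (λ { g (s ∷ ys) → unfold g ys s })
  where
  unfold : ∀ g ys s → ⟦ recₜ zeroₜ (orElseₜ (π (suc zero)) (f ∘ₜ (π zero ∷ rest 2))) ⟧ g (s ∷ ys)
                      ≡ anyBelow (λ i → ⟦ f ⟧ g (i ∷ ys)) s
  unfold g ys zero    = refl
  unfold g ys (suc s) =
    cong₂ _orElse_ (unfold g ys s) (cong (λ zs → ⟦ f ⟧ g (s ∷ zs)) (⟦rest⟧* g (s ∷ _ ∷ []) ys))

guard-≢0⁺ : ∀ {a b} → a ≢ 0 → b ≢ 0 → guard a b ≢ 0
guard-≢0⁺ {zero}  a≢0 b≢0 = a≢0
guard-≢0⁺ {suc a} a≢0 b≢0 = b≢0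

guard-≢0⁻ : ∀ a {b} → guard a b ≢ 0 → a ≢ 0 × b ≢ 0
guard-≢0⁻ zero    ne = ⊥-elim (ne refl)
guard-≢0⁻ (suc a) ne = (λ ()) , ne

guard≡suc⁻ : ∀ a {b v} → guard a b ≡ suc v → a ≢ 0 × b ≡ suc v
guard≡suc⁻ zero    ()
guard≡suc⁻ (suc a) eq = (λ ()) , eq

orElse-≢0⁺ˡ : ∀ {a} b → a ≢ 0 → a orElse b ≢ 0
orElse-≢0⁺ˡ {zero}  b a≢0 = ⊥-elim (a≢0 refl)
orElse-≢0⁺ˡ {suc a} b a≢0 = λ ()

orElse-≢0⁺ʳ : ∀ a {b} → b ≢ 0 → a orElse b ≢ 0
orElse-≢0⁺ʳ zero    b≢0 = b≢0
orElse-≢0⁺ʳ (suc a) b≢0 = λ ()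

orElse-≢0⁻ : ∀ a {b} → a orElse b ≢ 0 → a ≢ 0 ⊎ b ≢ 0
orElse-≢0⁻ zero    ne = inj₂ ne
orElse-≢0⁻ (suc a) ne = inj₁ (λ ())

isZero-≢0⁺ : ∀ {a} → a ≡ 0 → isZero a ≢ 0
isZero-≢0⁺ refl = λ ()

isZero-≢0⁻ : ∀ a → isZero a ≢ 0 → a ≡ 0
isZero-≢0⁻ zero    ne = refl
isZero-≢0⁻ (suc a) ne = ⊥-elim (ne refl)

isZero-≡0 : ∀ {a} → a ≢ 0 → isZero a ≡ 0
isZero-≡0 {zero}  a≢0 = ⊥-elim (a≢0 refl)
isZero-≡0 {suc a} a≢0 = refl

equal-≢0⁻ : ∀ a b → equal a b ≢ 0 → a ≡ b
equal-≢0⁻ a b ne with guard-≢0⁻ (isZero (a ∸ b)) ne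
... | a∸b≡0 , b∸a≡0 = ≤-antisym (m∸n≡0⇒m≤n (isZero-≢0⁻ _ a∸b≡0)) (m∸n≡0⇒m≤n (isZero-≢0⁻ _ b∸a≡0))

equal-refl : ∀ a → equal a a ≢ 0
equal-refl a rewrite n∸n≡0 a = λ ()

anyBelow-≢0⁺ : ∀ h {s} i → i < s → h i ≢ 0 → anyBelow h s ≢ 0
anyBelow-≢0⁺ h {suc s} i i<1+s hi≢0 with m<1+n⇒m<n∨m≡n i<1+s
... | inj₁ i<s  = orElse-≢0⁺ˡ (h s) (anyBelow-≢0⁺ h i i<s hi≢0)
... | inj₂ refl = orElse-≢0⁺ʳ (anyBelow h s) hi≢0

anyBelow-≢0⁻ : ∀ h s → anyBelow h s ≢ 0 → ∃ λ i → i < s × h i ≢ 0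
anyBelow-≢0⁻ h zero    ne = ⊥-elim (ne refl)
anyBelow-≢0⁻ h (suc s) ne with orElse-≢0⁻ (anyBelow h s) ne
... | inj₁ ne′ = let (i , i<s , hi≢0) = anyBelow-≢0⁻ h s ne′ in i , m≤n⇒m≤1+n i<s , hi≢0
... | inj₂ ne′ = s , ≤-refl , ne′

anyBelow-≡0 : ∀ h s → (∀ i → i < s → h i ≡ 0) → anyBelow h s ≡ 0
anyBelow-≡0 h zero    hz = refl
anyBelow-≡0 h (suc s) hz rewrite anyBelow-≡0 h s (λ i i<s → hz i (m≤n⇒m≤1+n i<s)) = hz s ≤-refl

FirstNonzero : (ℕ → ℕ) → ℕ → Set
FirstNonzero h y = h y ≢ 0 × (∀ i → i < y → h i ≡ 0)

firstNonzero : ∀ h {y} → h y ≢ 0 → ∃ (FirstNonzero h)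
firstNonzero h {y} hy≢0 = search 0 y (λ _ ()) hy≢0
  where
  search : ∀ k d → (∀ i → i < k → h i ≡ 0) → h (k + d) ≢ 0 → ∃ (FirstNonzero h)
  search k d below ne with h k ≟ 0
  search k d       below ne | no hk≢0 = k , hk≢0 , below
  search k zero    below ne | yes hk≡0 = ⊥-elim (ne (trans (cong h (+-identityʳ k)) hk≡0))
  search k (suc d) below ne | yes hk≡0 = search (suc k) d below′ (subst (λ i → h i ≢ 0) (+-suc k d) ne)
    where
    below′ : ∀ i → i < suc k → h i ≡ 0
    below′ i i<1+k with m<1+n⇒m<n∨m≡n i<1+k
    ... | inj₁ i<k  = below i i<k
    ... | inj₂ refl = hk≡0

-- Binary digits

parity : ℕ → ℕ
parity k = natRec 0 (λ _ → isZero) k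

half : ℕ → ℕ
half k = natRec 0 (λ i r → if0 (parity i) r (suc r)) k

halveTimes : ℕ → ℕ → ℕ
halveTimes k m = natRec m (λ _ → half) k

parityₜ : Total 1
parityₜ = withDenotation (recₜ zeroₜ (isZeroₜ (π (suc zero)))) (λ _ xs → parity (head xs))
            (λ { _ (k ∷ []) → refl })

halfₜ : Total 1
halfₜ = withDenotation
          (recₜ zeroₜ (if0ₜ (parityₜ ∘ₜ (π zero ∷ [])) (π (suc zero)) (sucₜ ∘ₜ (π (suc zero) ∷ []))))
          (λ _ xs → half (head xs)) (λ { _ (k ∷ []) → refl })

bitₜ : Total 2
bitₜ = parityₜ ∘ₜ (halveTimesₜ ∘ₜ (π (suc zero) ∷ π zero ∷ []) ∷ [])
  where
  halveTimesₜ : Total 2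
  halveTimesₜ = withDenotation (recₜ (π zero) (halfₜ ∘ₜ (π (suc zero) ∷ [])))
                  (λ _ xs → halveTimes (head xs) (head (tail xs))) (λ { _ (k ∷ m ∷ []) → refl })

parity-01 : ∀ k → parity k ≡ 0 ⊎ parity k ≡ 1
parity-01 zero = inj₁ refl
parity-01 (suc k) with parity k | parity-01 k
... | .0 | inj₁ refl = inj₂ refl
... | .1 | inj₂ refl = inj₁ refl

parity≡%2 : ∀ k → parity k ≡ k % 2
parity≡%2 zero          = refl
parity≡%2 (suc zero)    = refl
parity≡%2 (suc (suc k)) = begin
  parity (2 + k)   ≡⟨ parity-+2 ⟩
  parity k         ≡⟨ parity≡%2 k ⟩
  k % 2            ≡⟨ [m+n]%n≡m%n k 2 ⟨
  (k + 2) % 2      ≡⟨ cong (_% 2) (+-comm k 2) ⟩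
  (2 + k) % 2      ∎
  where
  open ≡-Reasoning
  parity-+2 : parity (2 + k) ≡ parity k
  parity-+2 with parity k | parity-01 k
  ... | .0 | inj₁ refl = refl
  ... | .1 | inj₂ refl = refl

half≡/2 : ∀ k → half k ≡ k / 2
half≡/2 zero          = refl
half≡/2 (suc zero)    = refl
half≡/2 (suc (suc k)) = begin
  half (2 + k)       ≡⟨ half-+2 ⟩
  suc (half k)       ≡⟨ cong suc (half≡/2 k) ⟩
  suc (k / 2)        ≡⟨ m/n≡1+[m∸n]/n {2 + k} {2} (s≤s (s≤s z≤n)) ⟨
  (2 + k) / 2        ∎
  where
  open ≡-Reasoning
  half-+2 : half (2 + k) ≡ suc (half k)
  half-+2 with parity k | parity-01 k
  ... | .0 | inj₁ refl = refl
  ... | .1 | inj₂ refl = refl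

parity∘halveTimes≡bit : ∀ m k → parity (halveTimes k m) ≡ bit m k
parity∘halveTimes≡bit m zero    = parity≡%2 m
parity∘halveTimes≡bit m (suc k) = begin
  parity (half (halveTimes k m))  ≡⟨ cong parity (halveTimes-half k) ⟨
  parity (halveTimes k (half m))  ≡⟨ cong (parity ∘ halveTimes k) (half≡/2 m) ⟩
  parity (halveTimes k (m / 2))   ≡⟨ parity∘halveTimes≡bit (m / 2) k ⟩
  bit (m / 2) k                   ∎
  where
  open ≡-Reasoning
  halveTimes-half : ∀ k → halveTimes k (half m) ≡ half (halveTimes k m)
  halveTimes-half zero    = refl
  halveTimes-half (suc k) = cong half (halveTimes-half k)

bit-01 : ∀ m k → bit m k ≡ 0 ⊎ bit m k ≡ 1
bit-01 m k = subst (λ b → b ≡ 0 ⊎ b ≡ 1) (parity∘halveTimes≡bit m k) (parity-01 (halveTimes k m))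

bit≡1⇒< : ∀ {m} k → bit m k ≡ 1 → k < m
bit≡1⇒< {zero}  zero    ()
bit≡1⇒< {suc m} zero    _  = s≤s z≤n
bit≡1⇒< {zero}  (suc k) eq = ⊥-elim (0≢1+n (trans (sym (bit0≡0 k)) eq))
  where
  bit0≡0 : ∀ k → bit 0 k ≡ 0
  bit0≡0 zero    = refl
  bit0≡0 (suc k) = bit0≡0 k
bit≡1⇒< {suc m} (suc k) eq = ≤-trans (s≤s (bit≡1⇒< k eq)) (m/n<m (suc m) 2 (s≤s (s≤s z≤n)))

-- A step-bounded interpreter

Eventually : (ℕ → Set) → Set
Eventually P = ∃ λ s₀ → ∀ {s} → s₀ ≤ s → P s

module _ {P Q : ℕ → Set} where

  eventually-map : (∀ {s} → P s → Q s) → Eventually P → Eventually Q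
  eventually-map f (s₀ , p) = s₀ , f ∘ p

  eventually-× : Eventually P → Eventually Q → Eventually (λ s → P s × Q s)
  eventually-× (s₀ , p) (s₁ , q) = s₀ ⊔ s₁ , λ le → p (≤-trans (m≤m⊔n s₀ s₁) le) , q (≤-trans (m≤n⊔m s₀ s₁) le)

eventually-≥ : ∀ y → Eventually (y ≤_)
eventually-≥ y = y , λ le → le

eventually-∀< : (Q : ℕ → ℕ → Set) → ∀ y → (∀ i → i < y → Eventually (Q i)) →
                Eventually (λ s → ∀ i → i < y → Q i s)
eventually-∀< Q zero    ev = 0 , λ _ i ()
eventually-∀< Q (suc y) ev =
  eventually-map extend (eventually-× (eventually-∀< Q y (λ i i<y → ev i (m≤n⇒m≤1+n i<y))) (ev y ≤-refl))
  where
  extend : ∀ {s} → (∀ i → i < y → Q i s) × Q y s → ∀ i → i < suc y → Q i s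
  extend (below , at) i i<1+y with m<1+n⇒m<n∨m≡n i<1+y
  ... | inj₁ i<y  = below i i<y
  ... | inj₂ refl = at

conj : ∀ {m} → Vec ℕ m → ℕ
conj []       = 1
conj (c ∷ cs) = guard c (conj cs)

-- The state of a μ-search is 0 (a test did not converge in time), 1 (searching) or 2 + y (found y).
muStep : ℕ → ℕ → ℕ → ℕ
muStep zero                c             j = 0
muStep (suc zero)          zero          j = 0
muStep (suc zero)          (suc zero)    j = suc (suc j)
muStep (suc zero)          (suc (suc _)) j = 1
muStep (suc (suc y))       c             j = suc (suc y)

muResult : ℕ → ℕ
muResult (suc (suc y)) = suc y
muResult _             = 0

-- clocked o t s xs is suc v if t converges to v with every μ-search cut off at s, and 0 otherwise.
mutual
  clocked : ∀ {n} → (ℕ → ℕ) → Term n → ℕ → Vec ℕ n → ℕ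
  clocked o zer         s xs = 1
  clocked o succ        s xs = suc (suc (head xs))
  clocked o (proj i)    s xs = suc (lookup xs i)
  clocked o oracle      s xs = suc (o (head xs))
  clocked o (comp h fs) s xs = guard (conj (clocked* o fs s xs)) (clocked o h s (map pred (clocked* o fs s xs)))
  clocked o (prec f h)  s xs =
    natRec (clocked o f s (tail xs)) (λ k r → guard r (clocked o h s (k ∷ pred r ∷ tail xs))) (head xs)
  clocked o (mu f)      s xs = muResult (muSearch o f s xs s)

  clocked* : ∀ {m n} → (ℕ → ℕ) → Vec (Term n) m → ℕ → Vec ℕ n → Vec ℕ m
  clocked* o []       s xs = []
  clocked* o (f ∷ fs) s xs = clocked o f s xs ∷ clocked* o fs s xs

  muSearch : ∀ {n} → (ℕ → ℕ) → Term (suc n) → ℕ → Vec ℕ n → ℕ → ℕ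
  muSearch o f s xs zero    = 1
  muSearch o f s xs (suc j) = muStep (muSearch o f s xs j) (clocked o f s (j ∷ xs)) j

PositiveBelow : ∀ {n} → (ℕ → ℕ) → Term (suc n) → ℕ → Vec ℕ n → ℕ → Set
PositiveBelow o f s xs y = ∀ i → i < y → ∃ λ w → clocked o f s (i ∷ xs) ≡ suc (suc w)

muSearch-sound : ∀ {n} o (f : Term (suc n)) s xs j →
  (muSearch o f s xs j ≡ 1 → PositiveBelow o f s xs j) ×
  (∀ y → muSearch o f s xs j ≡ suc (suc y) → clocked o f s (y ∷ xs) ≡ 1 × PositiveBelow o f s xs y)
muSearch-sound o f s xs zero = (λ _ i ()) , (λ y ())
muSearch-sound o f s xs (suc j)
  with muSearch o f s xs j | muSearch-sound o f s xs j | clocked o f s (j ∷ xs) in eq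
... | zero          | _               | c           = (λ ()) , (λ y ())
... | suc zero      | _               | zero        = (λ ()) , (λ y ())
... | suc zero      | searching , _   | suc zero    = (λ ()) , (λ { y refl → eq , searching refl })
... | suc zero      | searching , _   | suc (suc w) = (λ _ → extend (searching refl)) , (λ y ())
  where
  extend : PositiveBelow o f s xs j → PositiveBelow o f s xs (suc j)
  extend below i i<1+j with m<1+n⇒m<n∨m≡n i<1+j
  ... | inj₁ i<j  = below i i<j
  ... | inj₂ refl = w , eq
... | suc (suc y)   | _ , found       | c           = (λ ()) , found

mutual
  clocked-sound : ∀ {n} o (t : Term n) s xs {v} → clocked o t s xs ≡ suc v → o ⊢ t [ xs ]⇓ v
  clocked-sound o zer      s xs       refl = ev-zer
  clocked-sound o succ     s (x ∷ []) refl = ev-succ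
  clocked-sound o (proj i) s xs       refl = ev-proj
  clocked-sound o oracle   s (x ∷ []) refl = ev-orac
  clocked-sound o (comp h fs) s xs eq with guard≡suc⁻ (conj (clocked* o fs s xs)) eq
  ... | conj≢0 , eqₕ = ev-comp (clocked*-sound o fs s xs conj≢0) (clocked-sound o h s _ eqₕ)
  clocked-sound o (prec f h) s (k ∷ ys) eq = rec k eq
    where
    rec : ∀ k {v} → clocked o (prec f h) s (k ∷ ys) ≡ suc v → o ⊢ prec f h [ k ∷ ys ]⇓ v
    rec zero    eq = ev-prec0 (clocked-sound o f s ys eq)
    rec (suc k) eq with clocked o (prec f h) s (k ∷ ys) in eqₖ
    ... | suc r = ev-precS (rec k eqₖ) (clocked-sound o h s _ eq)
  clocked-sound o (mu f) s xs {v} eq =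
    let hit , below = proj₂ (muSearch-sound o f s xs s) v (found (muSearch o f s xs s) eq) in
    ev-mu (clocked-sound o f s (v ∷ xs) hit)
          (λ i i<v → let w , eqᵢ = below i i<v in w , clocked-sound o f s (i ∷ xs) eqᵢ)
    where
    found : ∀ state → muResult state ≡ suc v → state ≡ suc (suc v)
    found (suc (suc y)) refl = refl

  clocked*-sound : ∀ {m n} o (fs : Vec (Term n) m) s xs →
                   conj (clocked* o fs s xs) ≢ 0 → o ⊢ fs [ xs ]⇓* map pred (clocked* o fs s xs)
  clocked*-sound o []       s xs ne = ev-[]
  clocked*-sound o (f ∷ fs) s xs ne with clocked o f s xs in eq
  ... | zero  = ⊥-elim (ne refl)
  ... | suc c = ev-∷ (clocked-sound o f s xs eq) (clocked*-sound o fs s xs ne)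

muSearch-searching : ∀ {n} o (f : Term (suc n)) s xs {y} → PositiveBelow o f s xs y →
                     ∀ j → j ≤ y → muSearch o f s xs j ≡ 1
muSearch-searching o f s xs below zero    _   = refl
muSearch-searching o f s xs below (suc j) j<y
  with muSearch-searching o f s xs below j (<⇒≤ j<y) | below j j<y
... | eqⱼ | w , eq rewrite eqⱼ | eq = refl

muSearch-found : ∀ {n} o (f : Term (suc n)) s xs {y} → clocked o f s (y ∷ xs) ≡ 1 →
                 PositiveBelow o f s xs y → ∀ j → y < j → muSearch o f s xs j ≡ suc (suc y)
muSearch-found o f s xs {y} hit below (suc j) y<1+j with m<1+n⇒m<n∨m≡n y<1+j
... | inj₁ y<j  rewrite muSearch-found o f s xs hit below j y<j = refl
... | inj₂ refl rewrite muSearch-searching o f s xs below y ≤-refl | hit = refl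

mutual
  clocked-complete : ∀ {n} {o} {t : Term n} {xs v} → o ⊢ t [ xs ]⇓ v →
                     Eventually (λ s → clocked o t s xs ≡ suc v)
  clocked-complete ev-zer  = 0 , λ _ → refl
  clocked-complete ev-succ = 0 , λ _ → refl
  clocked-complete ev-proj = 0 , λ _ → refl
  clocked-complete ev-orac = 0 , λ _ → refl
  clocked-complete {o = o} (ev-comp {h = h} {fs} {xs} {ys} {v} d* d) =
    eventually-map step (eventually-× (clocked*-complete d*) (clocked-complete d))
    where
    conj-suc : ∀ {m} (ys : Vec ℕ m) → conj (map suc ys) ≢ 0
    conj-suc []       = λ ()
    conj-suc (y ∷ ys) = conj-suc ys
    pred∘suc : ∀ {m} (ys : Vec ℕ m) → map pred (map suc ys) ≡ ys
    pred∘suc []       = refl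
    pred∘suc (y ∷ ys) = cong (y ∷_) (pred∘suc ys)
    step : ∀ {s} → clocked* o fs s xs ≡ map suc ys × clocked o h s ys ≡ suc v →
           clocked o (comp h fs) s xs ≡ suc v
    step (eq* , eq) rewrite eq* | pred∘suc ys with conj (map suc ys) | conj-suc ys
    ... | zero  | ne = ⊥-elim (ne refl)
    ... | suc _ | _  = eq
  clocked-complete (ev-prec0 d) = clocked-complete d
  clocked-complete {o = o} (ev-precS {f = f} {h} {k} {xs} {r} {v} dᵣ d) =
    eventually-map step (eventually-× (clocked-complete dᵣ) (clocked-complete d))
    where
    step : ∀ {s} → clocked o (prec f h) s (k ∷ xs) ≡ suc r × clocked o h s (k ∷ r ∷ xs) ≡ suc v →
           clocked o (prec f h) s (suc k ∷ xs) ≡ suc v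
    step (eqᵣ , eq) rewrite eqᵣ = eq
  clocked-complete {o = o} (ev-mu {f = f} {xs} {y} d₀ dᵢ) =
    eventually-map (λ { (hit , below , y<s) → cong muResult (muSearch-found o f _ xs hit below _ y<s) })
      (eventually-× (clocked-complete d₀)
        (eventually-× (eventually-∀< (λ i s → ∃ λ w → clocked o f s (i ∷ xs) ≡ suc (suc w)) y positive)
                      (eventually-≥ (suc y))))
    where
    positive : ∀ i → i < y → Eventually (λ s → ∃ λ w → clocked o f s (i ∷ xs) ≡ suc (suc w))
    positive i i<y = let w , d = dᵢ i i<y in eventually-map (w ,_) (clocked-complete d)

  clocked*-complete : ∀ {m n} {o} {fs : Vec (Term n) m} {xs ys} → o ⊢ fs [ xs ]⇓* ys →
                      Eventually (λ s → clocked* o fs s xs ≡ map suc ys)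
  clocked*-complete ev-[]       = 0 , λ _ → refl
  clocked*-complete (ev-∷ d ds) =
    eventually-map (λ (eq , eq*) → cong₂ _∷_ eq eq*) (eventually-× (clocked-complete d) (clocked*-complete ds))

clocked≡suc-unique : ∀ {n} {o} {t : Term n} {s xs v w} → clocked o t s xs ≡ suc v →
                     Eventually (λ s → clocked o t s xs ≡ suc w) → v ≡ w
clocked≡suc-unique {o = o} {t} {s} {xs} eq evʷ =
  let s₀ , both = eventually-× (clocked-complete (clocked-sound o t s xs eq)) evʷ
      eqᵛ , eqʷ = both ≤-refl
  in suc-injective (trans (sym eqᵛ) eqʷ)

mutual
  conjₜ : ∀ m → Total m
  conjₜ m = withDenotation (conjRec m) (λ _ → conj) (⟦conjRec⟧ m)

  conjRec : ∀ m → Total m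
  conjRec zero    = oneₜ
  conjRec (suc m) = guardₜ (π zero) (conjₜ m ∘ₜ rest 1)

  ⟦conjRec⟧ : ∀ m g xs → ⟦ conjRec m ⟧ g xs ≡ conj xs
  ⟦conjRec⟧ zero    g []       = refl
  ⟦conjRec⟧ (suc m) g (x ∷ xs) = cong (guard x ∘ conj) (⟦rest⟧* g (x ∷ []) xs)

muStepₜ : ∀ {n} → Total n → Total n → Total n → Total n
muStepₜ b c j =
  withDenotation
    (if0ₜ (predₜ b) (if0ₜ b b (if0ₜ c zeroₜ (if0ₜ (predₜ c) (sucₜ ∘ₜ (sucₜ ∘ₜ (j ∷ []) ∷ [])) oneₜ))) b)
    (λ g xs → muStep (⟦ b ⟧ g xs) (⟦ c ⟧ g xs) (⟦ j ⟧ g xs)) (λ g xs → cases (⟦ b ⟧ g xs) (⟦ c ⟧ g xs) _)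
  where
  cases : ∀ b c j → if0 (pred b) (if0 b b (if0 c 0 (if0 (pred c) (suc (suc j)) 1))) b ≡ muStep b c j
  cases zero                c             j = refl
  cases (suc zero)          zero          j = refl
  cases (suc zero)          (suc zero)    j = refl
  cases (suc zero)          (suc (suc c)) j = refl
  cases (suc (suc b))       c             j = refl

muResultₜ : ∀ {n} → Total n → Total n
muResultₜ x = withDenotation (if0ₜ (predₜ x) zeroₜ (predₜ x)) (λ g xs → muResult (⟦ x ⟧ g xs))
                (λ g xs → cases (⟦ x ⟧ g xs))
  where
  cases : ∀ b → if0 (pred b) 0 (pred b) ≡ muResult b
  cases zero          = refl
  cases (suc zero)    = refl
  cases (suc (suc b)) = refl

oracleOf : Total 1 → (ℕ → ℕ) → ℕ → ℕ
oracleOf oc g x = ⟦ oc ⟧ g (x ∷ [])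

mutual
  clockedₜ : ∀ {n} → Total 1 → Term n → Total (suc n)
  clockedₜ oc t = withDenotation (clockedRec oc t) (λ g xs → clocked (oracleOf oc g) t (head xs) (tail xs))
                    (⟦clockedRec⟧ oc t)

  clockedₜ* : ∀ {m n} → Total 1 → Vec (Term n) m → Vec (Total (suc n)) m
  clockedₜ* oc []       = []
  clockedₜ* oc (f ∷ fs) = clockedₜ oc f ∷ clockedₜ* oc fs

  clockedRec : ∀ {n} → Total 1 → Term n → Total (suc n)
  clockedRec oc zer         = oneₜ
  clockedRec oc succ        = sucₜ ∘ₜ (sucₜ ∘ₜ (π (suc zero) ∷ []) ∷ [])
  clockedRec oc (proj i)    = sucₜ ∘ₜ (π (suc i) ∷ [])
  clockedRec oc oracle      = sucₜ ∘ₜ (oc ∘ₜ (π (suc zero) ∷ []) ∷ [])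
  clockedRec oc (comp {m} h fs) =
    guardₜ (conjₜ m ∘ₜ clockedₜ* oc fs) (clockedₜ oc h ∘ₜ (π zero ∷ map predₜ (clockedₜ* oc fs)))
  clockedRec oc (prec f h) =
    recₜ (clockedₜ oc f)
         (guardₜ (π (suc zero))
                 (clockedₜ oc h ∘ₜ (π (suc (suc zero)) ∷ π zero ∷ predₜ (π (suc zero)) ∷ rest 3)))
      ∘ₜ (π (suc zero) ∷ π zero ∷ rest 2)
  clockedRec oc (mu f) =
    muResultₜ (recₜ oneₜ (muSearchStepₜ oc f) ∘ₜ (π zero ∷ π zero ∷ rest 1))

  muSearchStepₜ : ∀ {n} → Total 1 → Term (suc n) → Total (suc (suc (suc n)))
  muSearchStepₜ oc f =
    muStepₜ (π (suc zero)) (clockedₜ oc f ∘ₜ (π (suc (suc zero)) ∷ π zero ∷ rest 3)) (π zero)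

  ⟦clockedₜ⟧* : ∀ {m n} oc (fs : Vec (Term n) m) g s xs →
                ⟦ clockedₜ* oc fs ⟧* g (s ∷ xs) ≡ clocked* (oracleOf oc g) fs s xs
  ⟦clockedₜ⟧* oc []       g s xs = refl
  ⟦clockedₜ⟧* oc (f ∷ fs) g s xs = cong (_ ∷_) (⟦clockedₜ⟧* oc fs g s xs)

  ⟦clockedRec⟧ : ∀ {n} oc (t : Term n) g xs →
                 ⟦ clockedRec oc t ⟧ g xs ≡ clocked (oracleOf oc g) t (head xs) (tail xs)
  ⟦clockedRec⟧ oc zer      g (s ∷ xs)     = refl
  ⟦clockedRec⟧ oc succ     g (s ∷ x ∷ []) = refl
  ⟦clockedRec⟧ oc (proj i) g (s ∷ xs)     = refl
  ⟦clockedRec⟧ oc oracle   g (s ∷ x ∷ []) = refl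
  ⟦clockedRec⟧ oc (comp h fs) g (s ∷ xs) =
    cong₂ guard (cong conj eq*)
                (cong (clocked (oracleOf oc g) h s) (trans (⟦map-predₜ⟧ (clockedₜ* oc fs)) (cong (map pred) eq*)))
    where
    eq* = ⟦clockedₜ⟧* oc fs g s xs
    ⟦map-predₜ⟧ : ∀ {m} (ts : Vec (Total _) m) → ⟦ map predₜ ts ⟧* g (s ∷ xs) ≡ map pred (⟦ ts ⟧* g (s ∷ xs))
    ⟦map-predₜ⟧ []       = refl
    ⟦map-predₜ⟧ (t ∷ ts) = cong (_ ∷_) (⟦map-predₜ⟧ ts)
  ⟦clockedRec⟧ oc (prec f h) g (s ∷ k ∷ ys) =
    natRec-cong _ _ (cong (clocked (oracleOf oc g) f s) ys′≡ys)
                (λ i r → cong (λ zs → guard r (clocked (oracleOf oc g) h s (i ∷ pred r ∷ zs)))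
                              (trans (⟦rest⟧* g (i ∷ r ∷ s ∷ []) _) ys′≡ys))
                k
    where
    ys′≡ys = ⟦rest⟧* g (s ∷ k ∷ []) ys
  ⟦clockedRec⟧ oc (mu f) g (s ∷ xs) = cong muResult (search s)
    where
    xs′≡xs = ⟦rest⟧* g (s ∷ []) xs
    search : ∀ j → ⟦ recₜ oneₜ (muSearchStepₜ oc f) ⟧ g (j ∷ s ∷ ⟦ rest 1 ⟧* g (s ∷ xs))
                   ≡ muSearch (oracleOf oc g) f s xs j
    search zero    = refl
    search (suc j) =
      cong₂ (λ b c → muStep b c j) (search j)
            (cong (λ zs → clocked (oracleOf oc g) f s (j ∷ zs)) (trans (⟦rest⟧* g (j ∷ _ ∷ s ∷ []) _) xs′≡xs))

-- Recognising effective Û-unions from names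

D_⊆range_ : ℕ → (ℕ → ℕ) → Set
D m ⊆range p = ∀ k → k ∈D m → ∃ λ l → p l ≡ k

D_⊆_[<_] : ℕ → (ℕ → ℕ) → ℕ → Set
D m ⊆ p [< s ] = ∀ k → k ∈D m → ∃ λ l → l < s × p l ≡ k

⊆range⇒Û : ∀ {X} {U : Family X} {x p m} → IsName U x p → D m ⊆range p → Û U m x
⊆range⇒Û {U = U} {x} {p} (listed , _) D⊆ =
  (λ k k∈Dm → let l , pl≡k = D⊆ k k∈Dm in subst (λ k → U k x) pl≡k (listed l)) , p 0 , listed 0

Û⇒⊆range : ∀ {X} {U : Family X} {x p m} → IsName U x p → Û U m x → D m ⊆range p
Û⇒⊆range (_ , exhaustive) (D⊆ , _) k k∈Dm = exhaustive k (D⊆ k k∈Dm)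

enumerator : ∀ {X} {U : Family X} {A} → IsEffUnion U A → Term 1
enumerator (_ , (e , _) , _) = e

effUnion⇔⊆range : ∀ {X} {U : Family X} {A} (eff : IsEffUnion U A) {x p} → IsName U x p →
                  A x ⇔ (∃ λ m → m ∈RE enumerator eff × D m ⊆range p)
effUnion⇔⊆range {U = U} (S , (e , S⇔) , A⇔) {x} name = mk⇔
  (λ x∈A → let m , m∈S , x∈Û = Equivalence.to (A⇔ x) x∈A in
           m , Equivalence.to (S⇔ m) m∈S , Û⇒⊆range {U = U} name x∈Û)
  (λ { (m , m∈S , D⊆) → Equivalence.from (A⇔ x) (m , Equivalence.from (S⇔ m) m∈S , ⊆range⇒Û {U = U} name D⊆) })

seen : (ℕ → ℕ) → ℕ → ℕ → ℕ
seen g k s = anyBelow (λ i → equal (g i) k) s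

coveredₜ : Total 2
coveredₜ = isZeroₜ (anyBelowₜ missing ∘ₜ (π zero ∷ π zero ∷ π (suc zero) ∷ []))
  where
  seenₜ : Total 2
  seenₜ = anyBelowₜ (equalₜ (oracleₜ ∘ₜ (π zero ∷ [])) (π (suc zero)))
  missing : Total 3
  missing = guardₜ (bitₜ ∘ₜ (π (suc zero) ∷ π zero ∷ []))
                   (isZeroₜ (seenₜ ∘ₜ (π (suc (suc zero)) ∷ π zero ∷ [])))

covered-sound : ∀ g m s → ⟦ coveredₜ ⟧ g (m ∷ s ∷ []) ≢ 0 → D m ⊆ g [< s ]
covered-sound g m s ne k k∈Dm with seen g k s ≟ 0
... | no seen≢0 = let i , i<s , eq = anyBelow-≢0⁻ _ s seen≢0 in i , i<s , equal-≢0⁻ _ _ eq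
... | yes seen≡0 = ⊥-elim (anyBelow-≢0⁺ _ k (bit≡1⇒< k k∈Dm) missing≢0 (isZero-≢0⁻ _ ne))
  where
  missing≢0 : guard (parity (halveTimes k m)) (isZero (seen g k s)) ≢ 0
  missing≢0 rewrite parity∘halveTimes≡bit m k | k∈Dm | seen≡0 = λ ()

covered-complete : ∀ g m s → D m ⊆ g [< s ] → ⟦ coveredₜ ⟧ g (m ∷ s ∷ []) ≢ 0
covered-complete g m s D⊆ = isZero-≢0⁺ (anyBelow-≡0 _ m (λ k _ → nothing-missing k))
  where
  nothing-missing : ∀ k → guard (parity (halveTimes k m)) (isZero (seen g k s)) ≡ 0
  nothing-missing k with bit-01 m k
  ... | inj₁ b≡0 rewrite parity∘halveTimes≡bit m k | b≡0 = refl
  ... | inj₂ b≡1 rewrite parity∘halveTimes≡bit m k | b≡1 =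
    let i , i<s , gi≡k = D⊆ k b≡1 in
    isZero-≡0 (anyBelow-≢0⁺ _ i i<s (subst (λ x → equal x k ≢ 0) (sym gi≡k) (equal-refl k)))

-- Nonzero at stage s iff some m < s is enumerated by e within s steps and D m ⊆ g [< s ].
witnessedₜ : Term 1 → Total 1
witnessedₜ e =
  anyBelowₜ (anyBelowₜ atClock ∘ₜ (π (suc zero) ∷ π zero ∷ π (suc zero) ∷ [])) ∘ₜ (π zero ∷ π zero ∷ [])
  where
  atClock : Total 3
  atClock = guardₜ (clockedₜ zeroₜ e ∘ₜ (π zero ∷ π (suc zero) ∷ []))
                   (coveredₜ ∘ₜ (π (suc zero) ∷ π (suc (suc zero)) ∷ []))

witnessed-sound : ∀ e g s → ⟦ witnessedₜ e ⟧ g (s ∷ []) ≢ 0 → ∃ λ m → m ∈RE e × D m ⊆range g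
witnessed-sound e g s ne =
  let m  , _ , ne′  = anyBelow-≢0⁻ _ s ne
      s′ , _ , ne″ = anyBelow-≢0⁻ _ s ne′
      halts , covered = guard-≢0⁻ (clocked (λ _ → 0) e s′ (m ∷ [])) ne″
  in m , enumerated halts , λ k k∈Dm → let l , _ , eq = covered-sound g m s covered k k∈Dm in l , eq
  where
  enumerated : ∀ {m s′} → clocked (λ _ → 0) e s′ (m ∷ []) ≢ 0 → m ∈RE e
  enumerated {m} {s′} ne with clocked (λ _ → 0) e s′ (m ∷ []) in eq
  ... | zero  = ⊥-elim (ne refl)
  ... | suc v = v , clocked-sound (λ _ → 0) e s′ (m ∷ []) eq

prefix-covers : ∀ {p m} → D m ⊆range p → Eventually (λ s → D m ⊆ p [< s ])
prefix-covers {p} {m} D⊆ =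
  eventually-map (λ below k k∈Dm → below k (bit≡1⇒< k k∈Dm) k∈Dm)
                 (eventually-∀< (λ k s → k ∈D m → ∃ λ l → l < s × p l ≡ k) m listedBy)
  where
  listedBy : ∀ k → k < m → Eventually (λ s → k ∈D m → ∃ λ l → l < s × p l ≡ k)
  listedBy k _ with bit m k ≟ 1
  ... | no k∉Dm  = 0 , λ _ k∈Dm → ⊥-elim (k∉Dm k∈Dm)
  ... | yes k∈Dm = let l , eq = D⊆ k k∈Dm in suc l , λ l<s _ → l , l<s , eq

witnessed-complete : ∀ e g {m} → m ∈RE e → D m ⊆range g → Eventually (λ s → ⟦ witnessedₜ e ⟧ g (s ∷ []) ≢ 0)
witnessed-complete e g {m} (v , d) D⊆ =
  let s₀ , halts = clocked-complete d in
  eventually-map (λ { (covered , m<s , s₀<s) →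
                      anyBelow-≢0⁺ _ m m<s (anyBelow-≢0⁺ _ s₀ s₀<s
                        (guard-≢0⁺ (λ eq → 0≢1+n (trans (sym eq) (halts ≤-refl)))
                                   (covered-complete g m _ covered))) })
    (eventually-× (prefix-covers D⊆) (eventually-× (eventually-≥ (suc m)) (eventually-≥ (suc s₀))))

-- The join operator

someWitnessedₜ : ∀ {n} → (Fin n → Term 1) → Total 1
someWitnessedₜ {zero}  e = zeroₜ
someWitnessedₜ {suc n} e = orElseₜ (witnessedₜ (e zero)) (someWitnessedₜ (e ∘ suc))

someWitnessed-complete : ∀ {n} (e : Fin n → Term 1) g s j →
                         ⟦ witnessedₜ (e j) ⟧ g (s ∷ []) ≢ 0 → ⟦ someWitnessedₜ e ⟧ g (s ∷ []) ≢ 0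
someWitnessed-complete e g s zero    ne = orElse-≢0⁺ˡ _ ne
someWitnessed-complete e g s (suc j) ne =
  orElse-≢0⁺ʳ (⟦ witnessedₜ (e zero) ⟧ g (s ∷ [])) (someWitnessed-complete (e ∘ suc) g s j ne)

-- On (c ∷ s ∷ x ∷ []): run γ j on x with clock c, for the first j witnessed at stage s.
dispatchₜ : ∀ {n} → (Fin n → Term 1) → (Fin n → Term 1) → Total 3
dispatchₜ {zero}  e γ = zeroₜ
dispatchₜ {suc n} e γ = if0ₜ (witnessedₜ (e zero) ∘ₜ (π (suc zero) ∷ []))
                             (dispatchₜ (e ∘ suc) (γ ∘ suc))
                             (clockedₜ oracleₜ (γ zero) ∘ₜ (π zero ∷ π (suc (suc zero)) ∷ []))

dispatch-first : ∀ {n} (e γ : Fin n → Term 1) g s → ⟦ someWitnessedₜ e ⟧ g (s ∷ []) ≢ 0 →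
                 ∃ λ j → ⟦ witnessedₜ (e j) ⟧ g (s ∷ []) ≢ 0 ×
                         (∀ c x → ⟦ dispatchₜ e γ ⟧ g (c ∷ s ∷ x ∷ []) ≡ clocked g (γ j) c (x ∷ []))
dispatch-first {zero}  e γ g s ne = ⊥-elim (ne refl)
dispatch-first {suc n} e γ g s ne with ⟦ witnessedₜ (e zero) ⟧ g (s ∷ []) in eq
... | suc _ = zero , (λ eq′ → 0≢1+n (trans (sym eq′) eq)) , λ c x → refl
... | zero  = let j , witⱼ , runs = dispatch-first (e ∘ suc) (γ ∘ suc) g s ne in suc j , witⱼ , runs

searchThen : ∀ {n} → Total (suc n) → Term (suc n) → Term n
searchThen h k = comp k (mu (term (isZeroₜ h)) ∷ terms (rest 0))

searchThen⇓ : ∀ {n} (h : Total (suc n)) (k : Term (suc n)) {g xs y v} →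
              FirstNonzero (λ y → ⟦ h ⟧ g (y ∷ xs)) y → g ⊢ k [ y ∷ xs ]⇓ v → g ⊢ searchThen h k [ xs ]⇓ v
searchThen⇓ h k {g} {xs} {y} (hy≢0 , below) k⇓ =
  ev-comp (ev-∷ (ev-mu stop continue) arguments) k⇓
  where
  arguments : g ⊢ terms (rest 0) [ xs ]⇓* xs
  arguments = subst (g ⊢ terms (rest 0) [ xs ]⇓*_) (⟦rest⟧* g [] xs) (evaluates* (rest 0) g xs)
  stop : g ⊢ term (isZeroₜ h) [ y ∷ xs ]⇓ 0
  stop = subst (g ⊢ term (isZeroₜ h) [ y ∷ xs ]⇓_) (isZero-≡0 hy≢0) (evaluates (isZeroₜ h) g (y ∷ xs))
  continue : ∀ i → i < y → ∃ λ w → g ⊢ term (isZeroₜ h) [ i ∷ xs ]⇓ suc w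
  continue i i<y =
    0 , subst (λ a → g ⊢ term (isZeroₜ h) [ i ∷ xs ]⇓ isZero a) (below i i<y) (evaluates (isZeroₜ h) g (i ∷ xs))

-- Runs the term simulated by h, searching for a clock at which the simulation has converged.
searchClock : ∀ {n} → Total (suc n) → Term n
searchClock h = searchThen h (term (predₜ h))

searchClock⇓ : ∀ {n m} (h : Total (suc n)) (t : Term m) {g xs ys v} →
               (∀ c → ⟦ h ⟧ g (c ∷ xs) ≡ clocked g t c ys) → g ⊢ t [ ys ]⇓ v → g ⊢ searchClock h [ xs ]⇓ v
searchClock⇓ h t {g} {xs} {ys} {v} simulates t⇓ =
  let s₀ , halts = clocked-complete t⇓
      c , first  = firstNonzero (λ c → ⟦ h ⟧ g (c ∷ xs)) (hs₀≢0 (halts ≤-refl))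
  in searchThen⇓ h _ first
       (subst (g ⊢ term (predₜ h) [ c ∷ xs ]⇓_)
              (trans (cong pred (simulates c))
                     (pred-converged (λ eq → proj₁ first (trans (simulates c) eq)) (s₀ , halts)))
              (evaluates (predₜ h) g (c ∷ xs)))
  where
  hs₀≢0 : ∀ {s₀} → clocked g t s₀ ys ≡ suc v → ⟦ h ⟧ g (s₀ ∷ xs) ≢ 0
  hs₀≢0 {s₀} halts eq = 0≢1+n (trans (sym eq) (trans (simulates s₀) halts))
  pred-converged : ∀ {c} → clocked g t c ys ≢ 0 → Eventually (λ s → clocked g t s ys ≡ suc v) →
                   pred (clocked g t c ys) ≡ v
  pred-converged {c} ne halts with clocked g t c ys in eq
  ... | zero  = ⊥-elim (ne refl)
  ... | suc w = clocked≡suc-unique {t = t} eq halts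

joinOperator : ∀ {n} → (Fin n → Term 1) → (Fin n → Term 1) → Operator
joinOperator e γ = searchThen (someWitnessedₜ e ∘ₜ (π zero ∷ [])) (searchClock (dispatchₜ e γ))

joinOperator-transforms : ∀ {n} (e γ : Fin n → Term 1) p →
  (∃ λ i → ∃ λ m → m ∈RE e i × D m ⊆range p) →
  ∃ λ j → (∃ λ m → m ∈RE e j × D m ⊆range p) ×
          (∀ q → γ j transforms p into q → joinOperator e γ transforms p into q)
joinOperator-transforms e γ p (i , m , m∈S , D⊆) =
  let s₀ , witnessedᵢ = witnessed-complete (e i) p m∈S D⊆
      s , first       = firstNonzero (λ s → ⟦ someWitnessedₜ e ⟧ p (s ∷ []))
                          (someWitnessed-complete e p s₀ i (witnessedᵢ ≤-refl))
      j , witnessedⱼ , runs = dispatch-first e γ p s (proj₁ first)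
  in j , witnessed-sound (e j) p s witnessedⱼ ,
     λ q γⱼ⇓ x → searchThen⇓ (someWitnessedₜ e ∘ₜ (π zero ∷ [])) _ first
                   (searchClock⇓ (dispatchₜ e γ) (γ j) (λ c → runs c x) (γⱼ⇓ x))

corollary4p5 : (X Y : Set) (U : Family X) (V : Family Y) (n : ℕ)
               (𝒜 : Fin n → X → Set) →
               (∀ i → IsEffUnion U (𝒜 i)) →
               StronglyJoinPermitting U V 𝒜
corollary4p5 X Y U V n 𝒜 effective F isFunction covered restrictions =
  isFunction , inUnions , joinOperator e γ , transforms
  where
  e : Fin n → Term 1
  e i = enumerator (effective i)
  γ : Fin n → Operator
  γ i = proj₁ (proj₂ (proj₂ (restrictions i)))

  inUnions : ∀ {x y} → F x y → ⋃ U x × ⋃ V y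
  inUnions Fxy = let i , x∈𝒜ᵢ = covered (_ , Fxy) in proj₁ (proj₂ (restrictions i)) (x∈𝒜ᵢ , Fxy)

  transforms : ∀ {x y} → F x y → ∀ p → IsName U x p →
               ∃ λ q → (joinOperator e γ transforms p into q) × IsName V y q
  transforms Fxy p name =
    let i , x∈𝒜ᵢ = covered (_ , Fxy)
        j , witness , join⇓ = joinOperator-transforms e γ p
                                (i , Equivalence.to (effUnion⇔⊆range (effective i) name) x∈𝒜ᵢ)
        x∈𝒜ⱼ = Equivalence.from (effUnion⇔⊆range (effective j) name) witness
        q , γⱼ⇓ , q-name = proj₂ (proj₂ (proj₂ (restrictions j))) (x∈𝒜ⱼ , Fxy) p name
    in q , join⇓ q γⱼ⇓ , q-name
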